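{- For each $k\in\{1,2,3,4\}$, all formulas $A_1,X_1,\dots,A_n,X_n,B,Y$: $(A_1,X_1),\dots,(A_n,X_n)\vdash_{OUT_k}(B,Y)$ if and only if $(A_1,X_1),\dots,(A_n,X_n)\vdash_{OUT_k^+}(B,Y)$ and $X_1,\dots,X_n\models Y$ in classical logic.
   Context: Formulas are classical propositional formulas built with $\top,\bot,\neg,\wedge,\vee,\to$; $\models$ denotes classical semantic entailment. An I/O pair is an ordered pair $(A,X)$ of formulas. Rules on pairs: (TOP) $(\top,\top)$ is derivable from no premises; (BOT) $(\bot,\bot)$ is derivable from no premises; (WO) from $(A,X)$ derive $(A,Y)$ whenever $X\models Y$; (SI) from $(A,X)$ derive $(B,X)$ whenever $B\models A$; (AND) from $(A,X_1)$ and $(A,X_2)$ derive $(A,X_1\wedge X_2)$; (OR) from $(A_1,X)$ and $(A_2,X)$ derive $(A_1\vee A_2,X)$; (CT) from $(A,X)$ and $(A\wedge X,Y)$ derive $(A,Y)$. The logics: $OUT_1$ = {TOP, WO, SI, AND}; $OUT_2$ = $OUT_1$ + OR; $OUT_3$ = $OUT_1$ + CT; $OUT_4$ = $OUT_1$ + OR + CT; $OUT_k^+$ = $OUT_k$ + BOT. $G\vdash_{L}(B,Y)$ means there is a finite tree with root $(B,Y)$, each leaf an element of $G$ or an axiom of $L$, and each non-leaf node obtained from its children by a rule of $L$. -}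

module Defs where

open import Data.Nat using (ℕ)
open import Data.Bool using (Bool; true; false; not; _∧_; _∨_; T)
open import Data.Product using (_×_; _,_; proj₂)
open import Data.List using (List; map)
open import Data.List.Relation.Unary.All using (All)
open import Data.List.Membership.Propositional using (_∈_)

data Fm : Set where
  var  : ℕ → Fm
  ⊤ᶠ   : Fm
  ⊥ᶠ   : Fm
  ¬ᶠ_  : Fm → Fm
  _∧ᶠ_ : Fm → Fm → Fm
  _∨ᶠ_ : Fm → Fm → Fm
  _⇒ᶠ_ : Fm → Fm → Fm

Valuation : Set
Valuation = ℕ → Bool

⟦_⟧ : Fm → Valuation → Bool
⟦ var n ⟧ v = v n
⟦ ⊤ᶠ ⟧ v = true
⟦ ⊥ᶠ ⟧ v = false
⟦ ¬ᶠ A ⟧ v = not (⟦ A ⟧ v)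
⟦ A ∧ᶠ B ⟧ v = ⟦ A ⟧ v ∧ ⟦ B ⟧ v
⟦ A ∨ᶠ B ⟧ v = ⟦ A ⟧ v ∨ ⟦ B ⟧ v
⟦ A ⇒ᶠ B ⟧ v = not (⟦ A ⟧ v) ∨ ⟦ B ⟧ v

_⊨_ : Fm → Fm → Set
A ⊨ B = ∀ (v : Valuation) → T (⟦ A ⟧ v) → T (⟦ B ⟧ v)

_⊨*_ : List Fm → Fm → Set
Γ ⊨* B = ∀ (v : Valuation) → All (λ A → T (⟦ A ⟧ v)) Γ → T (⟦ B ⟧ v)

Pair : Set
Pair = Fm × Fm

data OutK : Set where
  out1 out2 out3 out4 : OutK

hasOR : OutK → Bool
hasOR out1 = false
hasOR out2 = true
hasOR out3 = false
hasOR out4 = true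

hasCT : OutK → Bool
hasCT out1 = false
hasCT out2 = false
hasCT out3 = true
hasCT out4 = true

-- Derivation trees: Derives k plus G p  means  G ⊢_L p  where
-- L = OUT_k if plus = false and L = OUT_k^+ if plus = true.
data Derives (k : OutK) (plus : Bool) (G : List Pair) : Pair → Set where
  leaf : ∀ {p} → p ∈ G → Derives k plus G p
  TOP  : Derives k plus G (⊤ᶠ , ⊤ᶠ)
  BOT  : T plus → Derives k plus G (⊥ᶠ , ⊥ᶠ)
  WO   : ∀ {A X Y} → X ⊨ Y → Derives k plus G (A , X) → Derives k plus G (A , Y)
  SI   : ∀ {A B X} → B ⊨ A → Derives k plus G (A , X) → Derives k plus G (B , X)
  AND  : ∀ {A X₁ X₂} → Derives k plus G (A , X₁) → Derives k plus G (A , X₂)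
       → Derives k plus G (A , X₁ ∧ᶠ X₂)
  OR   : ∀ {A₁ A₂ X} → T (hasOR k) → Derives k plus G (A₁ , X) → Derives k plus G (A₂ , X)
       → Derives k plus G (A₁ ∨ᶠ A₂ , X)
  CT   : ∀ {A X Y} → T (hasCT k) → Derives k plus G (A , X) → Derives k plus G (A ∧ᶠ X , Y)
       → Derives k plus G (A , Y)

outputs : List Pair → List Fm
outputs G = map proj₂ G

-- Soundness gives the entailment from the outputs. Conversely let O be the conjunction of
-- the outputs of G. Without BOT one still derives (⊥, O) from the leaves by SI and AND, so BOT
-- can be simulated at the price of weakening outputs by O: every OUT_k^+-derivable (A, X)
-- yields an OUT_k-derivable (A, X ∨ O), and WO removes the disjunct O once O ⊨ X.
-- CT breaks this invariant and needs a stronger one. For OUT_4 one also carries (A ∧ ¬X, O),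
-- so that CT can be replaced by OR over the cases X and ¬X. For OUT_3, which has no OR, one
-- carries a BOT-free output Z with A ∧ Z ⊨ X and Z ⊨ X ∨ O; then A ∧ Z can stand in for the
-- antecedent A ∧ X of CT.
module Submission where

open import Defs
open import Data.Bool using (Bool; true; false; not; T)
open import Data.Bool.Properties using (T-∧; T-∨)
open import Data.Empty using (⊥; ⊥-elim)
open import Data.List using (List; []; _∷_; foldr)
open import Data.List.Membership.Propositional using (_∈_)
open import Data.List.Membership.Propositional.Properties using (∈-map⁺)
open import Data.List.Relation.Binary.Subset.Propositional using (_⊆_)
open import Data.List.Relation.Unary.All as All using (All; []; _∷_)
open import Data.List.Relation.Unary.Any using (here; there)
open import Data.Product using (_×_; _,_; proj₁; proj₂)
open import Data.Product.Function.NonDependent.Propositional using (_×-⇔_)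
open import Data.Sum using (_⊎_; inj₁; inj₂; [_,_]; [_,_]′)
open import Data.Sum.Function.Propositional using (_⊎-⇔_)
open import Data.Unit using (⊤; tt)
open import Function using (_∘_; id)
open import Function.Bundles using (_⇔_; mk⇔; Equivalence)
open import Function.Construct.Composition using (_⇔-∘_)
open import Function.Construct.Identity using (⇔-id)
open import Function.Construct.Symmetry using (⇔-sym)
open import Function.Related.TypeIsomorphisms using (¬-cong-⇔)
open import Relation.Nullary using (¬_)
open import Relation.Binary.PropositionalEquality using (refl)

open Equivalence using (to; from)

variable
  k : OutK
  plus : Bool
  G : List Pair
  A B C D X Y X₁ X₂ : Fm
  Γ : List Fm
  v : Valuation

infix 4 _⊩_ _⊫_

_⊩_ : Valuation → Fm → Set
v ⊩ var n = T (v n)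
v ⊩ ⊤ᶠ = ⊤
v ⊩ ⊥ᶠ = ⊥
v ⊩ ¬ᶠ A = ¬ v ⊩ A
v ⊩ A ∧ᶠ B = v ⊩ A × v ⊩ B
v ⊩ A ∨ᶠ B = v ⊩ A ⊎ v ⊩ B
v ⊩ A ⇒ᶠ B = ¬ v ⊩ A ⊎ v ⊩ B

¬-cong-T : ∀ {P : Set} {b} → P ⇔ T b → (¬ P) ⇔ T (not b)
¬-cong-T {b = true}  P⇔T = mk⇔ (λ ¬p → ¬p (from P⇔T tt)) (λ ())
¬-cong-T {b = false} P⇔T = mk⇔ (λ _ → tt) (λ _ → to P⇔T)

⊩⇔T⟦⟧ : ∀ v A → v ⊩ A ⇔ T (⟦ A ⟧ v)
⊩⇔T⟦⟧ v (var n) = ⇔-id _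
⊩⇔T⟦⟧ v ⊤ᶠ = ⇔-id _
⊩⇔T⟦⟧ v ⊥ᶠ = ⇔-id _
⊩⇔T⟦⟧ v (¬ᶠ A) = ¬-cong-T (⊩⇔T⟦⟧ v A)
⊩⇔T⟦⟧ v (A ∧ᶠ B) = ⇔-sym T-∧ ⇔-∘ (⊩⇔T⟦⟧ v A ×-⇔ ⊩⇔T⟦⟧ v B)
⊩⇔T⟦⟧ v (A ∨ᶠ B) = ⇔-sym T-∨ ⇔-∘ (⊩⇔T⟦⟧ v A ⊎-⇔ ⊩⇔T⟦⟧ v B)
⊩⇔T⟦⟧ v (A ⇒ᶠ B) = ⇔-sym T-∨ ⇔-∘ (¬-cong-T (⊩⇔T⟦⟧ v A) ⊎-⇔ ⊩⇔T⟦⟧ v B)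

⊩-em : ∀ v A → v ⊩ A ⊎ ¬ v ⊩ A
⊩-em v A with ⟦ A ⟧ v | ⊩⇔T⟦⟧ v A
... | true  | A⇔ = inj₁ (from A⇔ tt)
... | false | A⇔ = inj₂ (to A⇔)

-- A record rather than ⊨, so that Agda can infer the formulas from an entailment:
-- ⟦_⟧ is not injective, while record types are.
record _⊫_ (A B : Fm) : Set where
  constructor ⊫-intro
  field
    ⊫-elim : v ⊩ A → v ⊩ B

open _⊫_

⊫⇔⊨ : A ⊫ B ⇔ A ⊨ B
⊫⇔⊨ {A} {B} = mk⇔
  (λ A⊫B v → to (⊩⇔T⟦⟧ v B) ∘ ⊫-elim A⊫B ∘ from (⊩⇔T⟦⟧ v A))
  (λ A⊨B → ⊫-intro λ {v} → from (⊩⇔T⟦⟧ v B) ∘ A⊨B v ∘ to (⊩⇔T⟦⟧ v A))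

⊫-refl : A ⊫ A
⊫-refl = ⊫-intro id

⊫-trans : A ⊫ B → B ⊫ C → A ⊫ C
⊫-trans A⊫B B⊫C = ⊫-intro (⊫-elim B⊫C ∘ ⊫-elim A⊫B)

⊥ᶠ-elim : ⊥ᶠ ⊫ A
⊥ᶠ-elim = ⊫-intro λ ()

∧-intro : A ⊫ B → A ⊫ C → A ⊫ B ∧ᶠ C
∧-intro A⊫B A⊫C = ⊫-intro λ a → ⊫-elim A⊫B a , ⊫-elim A⊫C a

∧-elimˡ : A ∧ᶠ B ⊫ A
∧-elimˡ = ⊫-intro proj₁

∧-elimʳ : A ∧ᶠ B ⊫ B
∧-elimʳ = ⊫-intro proj₂

∧-mono : A ⊫ B → C ⊫ D → A ∧ᶠ C ⊫ B ∧ᶠ D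
∧-mono A⊫B C⊫D = ∧-intro (⊫-trans ∧-elimˡ A⊫B) (⊫-trans ∧-elimʳ C⊫D)

∨-introˡ : A ⊫ A ∨ᶠ B
∨-introˡ = ⊫-intro inj₁

∨-introʳ : B ⊫ A ∨ᶠ B
∨-introʳ = ⊫-intro inj₂

∨-elim : A ⊫ C → B ⊫ C → A ∨ᶠ B ⊫ C
∨-elim A⊫C B⊫C = ⊫-intro [ ⊫-elim A⊫C , ⊫-elim B⊫C ]

∨-monoˡ : A ⊫ B → A ∨ᶠ C ⊫ B ∨ᶠ C
∨-monoˡ A⊫B = ∨-elim (⊫-trans A⊫B ∨-introˡ) ∨-introʳ

∨-factorʳ-∧ : (A ∨ᶠ C) ∧ᶠ (B ∨ᶠ C) ⊫ (A ∧ᶠ B) ∨ᶠ C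
∨-factorʳ-∧ = ⊫-intro λ where
  (inj₁ a , inj₁ b) → inj₁ (a , b)
  (inj₁ _ , inj₂ c) → inj₂ c
  (inj₂ c , _)      → inj₂ c

∧-distribʳ-∨ : (A ∨ᶠ B) ∧ᶠ C ⊫ (A ∧ᶠ C) ∨ᶠ (B ∧ᶠ C)
∧-distribʳ-∨ = ⊫-intro λ where
  (inj₁ a , c) → inj₁ (a , c)
  (inj₂ b , c) → inj₂ (b , c)

¬-anti : A ⊫ B → ¬ᶠ B ⊫ ¬ᶠ A
¬-anti A⊫B = ⊫-intro λ ¬b → ¬b ∘ ⊫-elim A⊫B

∧¬-contradiction : (A ∧ᶠ (¬ᶠ X)) ∧ᶠ X ⊫ ⊥ᶠ
∧¬-contradiction = ⊫-intro λ ((_ , ¬x) , x) → ¬x x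

∧-split : A ⊫ (A ∧ᶠ X) ∨ᶠ (A ∧ᶠ (¬ᶠ X))
∧-split {X = X} = ⊫-intro λ {v} a → [ inj₁ ∘ (a ,_) , inj₂ ∘ (a ,_) ]′ (⊩-em v X)

∧¬∧-split : A ∧ᶠ (¬ᶠ (X ∧ᶠ Y)) ⊫ (A ∧ᶠ (¬ᶠ X)) ∨ᶠ (A ∧ᶠ (¬ᶠ Y))
∧¬∧-split {X = X} = ⊫-intro λ {v} (a , ¬xy) →
  [ (λ x → inj₂ (a , λ y → ¬xy (x , y))) , (λ ¬x → inj₁ (a , ¬x)) ]′ (⊩-em v X)

∧¬-split : A ∧ᶠ (¬ᶠ Y) ⊫ (A ∧ᶠ (¬ᶠ X)) ∨ᶠ ((A ∧ᶠ X) ∧ᶠ (¬ᶠ Y))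
∧¬-split {X = X} = ⊫-intro λ {v} (a , ¬y) →
  [ (λ x → inj₂ ((a , x) , ¬y)) , (λ ¬x → inj₁ (a , ¬x)) ]′ (⊩-em v X)

⋀ : List Fm → Fm
⋀ = foldr _∧ᶠ_ ⊤ᶠ

⊩⋀⇔All : v ⊩ ⋀ Γ ⇔ All (v ⊩_) Γ
⊩⋀⇔All {Γ = []} = mk⇔ (λ _ → []) (λ _ → tt)
⊩⋀⇔All {Γ = A ∷ Γ} = mk⇔
  (λ (a , as) → a ∷ to ⊩⋀⇔All as)
  (λ { (a ∷ as) → a , from ⊩⋀⇔All as })

⊨*⇔⋀⊫ : Γ ⊨* Y ⇔ ⋀ Γ ⊫ Y
⊨*⇔⋀⊫ {Γ} {Y} = mk⇔
  (λ Γ⊨Y → ⊫-intro λ {v} →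
    from (⊩⇔T⟦⟧ v Y) ∘ Γ⊨Y v ∘ All.map (λ {A} → to (⊩⇔T⟦⟧ v A)) ∘ to ⊩⋀⇔All)
  (λ ⋀Γ⊫Y v →
    to (⊩⇔T⟦⟧ v Y) ∘ ⊫-elim ⋀Γ⊫Y ∘ from ⊩⋀⇔All ∘ All.map (λ {A} → from (⊩⇔T⟦⟧ v A)))

⋀-elim : X ∈ Γ → ⋀ Γ ⊫ X
⋀-elim (here refl) = ∧-elimˡ
⋀-elim (there X∈Γ) = ⊫-trans ∧-elimʳ (⋀-elim X∈Γ)

WO⊫ : X ⊫ Y → Derives k plus G (A , X) → Derives k plus G (A , Y)
WO⊫ X⊫Y = WO (to ⊫⇔⊨ X⊫Y)

SI⊫ : B ⊫ A → Derives k plus G (A , X) → Derives k plus G (B , X)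
SI⊫ B⊫A = SI (to ⊫⇔⊨ B⊫A)

sound : Derives k false G (A , X) → ⋀ (outputs G) ⊫ X
sound (leaf p∈G) = ⋀-elim (∈-map⁺ proj₂ p∈G)
sound TOP = ⊫-intro _
sound (WO X⊨Y d) = ⊫-trans (sound d) (from ⊫⇔⊨ X⊨Y)
sound (SI _ d) = sound d
sound (AND d₁ d₂) = ∧-intro (sound d₁) (sound d₂)
sound (OR _ d₁ _) = sound d₁
sound (CT _ _ d₂) = sound d₂

OUT⊆OUT⁺ : Derives k false G (A , X) → Derives k plus G (A , X)
OUT⊆OUT⁺ (leaf p∈G) = leaf p∈G
OUT⊆OUT⁺ TOP = TOP
OUT⊆OUT⁺ (WO h d) = WO h (OUT⊆OUT⁺ d)
OUT⊆OUT⁺ (SI h d) = SI h (OUT⊆OUT⁺ d)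
OUT⊆OUT⁺ (AND d₁ d₂) = AND (OUT⊆OUT⁺ d₁) (OUT⊆OUT⁺ d₂)
OUT⊆OUT⁺ (OR h d₁ d₂) = OR h (OUT⊆OUT⁺ d₁) (OUT⊆OUT⁺ d₂)
OUT⊆OUT⁺ (CT h d₁ d₂) = CT h (OUT⊆OUT⁺ d₁) (OUT⊆OUT⁺ d₂)

⊥⊢⋀outputs⊆ : (L : List Pair) → L ⊆ G → Derives k plus G (⊥ᶠ , ⋀ (outputs L))
⊥⊢⋀outputs⊆ [] _ = SI⊫ ⊥ᶠ-elim TOP
⊥⊢⋀outputs⊆ (p ∷ L) L⊆G =
  AND (SI⊫ ⊥ᶠ-elim (leaf (L⊆G (here refl)))) (⊥⊢⋀outputs⊆ L (L⊆G ∘ there))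

⊥⊢⋀outputs : Derives k plus G (⊥ᶠ , ⋀ (outputs G))
⊥⊢⋀outputs {G = G} = ⊥⊢⋀outputs⊆ G id

module _ {G : List Pair} where

  private
    O : Fm
    O = ⋀ (outputs G)

  BOT-elim-noCT : ¬ T (hasCT k) → Derives k true G (A , X) → Derives k false G (A , X ∨ᶠ O)
  BOT-elim-noCT _ (leaf p∈G) = WO⊫ ∨-introˡ (leaf p∈G)
  BOT-elim-noCT _ TOP = WO⊫ ∨-introˡ TOP
  BOT-elim-noCT _ (BOT _) = WO⊫ ∨-introʳ ⊥⊢⋀outputs
  BOT-elim-noCT noCT (WO X⊨Y d) = WO⊫ (∨-monoˡ (from ⊫⇔⊨ X⊨Y)) (BOT-elim-noCT noCT d)
  BOT-elim-noCT noCT (SI h d) = SI h (BOT-elim-noCT noCT d)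
  BOT-elim-noCT noCT (AND d₁ d₂) =
    WO⊫ ∨-factorʳ-∧ (AND (BOT-elim-noCT noCT d₁) (BOT-elim-noCT noCT d₂))
  BOT-elim-noCT noCT (OR h d₁ d₂) = OR h (BOT-elim-noCT noCT d₁) (BOT-elim-noCT noCT d₂)
  BOT-elim-noCT noCT (CT hasCT _ _) = ⊥-elim (noCT hasCT)

  BOT-elim-OUT₄ : Derives out4 true G (A , X)
    → Derives out4 false G (A , X ∨ᶠ O) × Derives out4 false G (A ∧ᶠ (¬ᶠ X) , O)
  BOT-elim-OUT₄ (leaf p∈G) =
    WO⊫ ∨-introˡ (leaf p∈G) ,
    CT tt (SI⊫ ∧-elimˡ (leaf p∈G)) (SI⊫ ∧¬-contradiction ⊥⊢⋀outputs)
  BOT-elim-OUT₄ TOP = WO⊫ ∨-introˡ TOP , SI⊫ (⊫-intro λ (_ , ¬⊤) → ¬⊤ tt) ⊥⊢⋀outputs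
  BOT-elim-OUT₄ (BOT _) = WO⊫ ∨-introʳ ⊥⊢⋀outputs , SI⊫ ∧-elimˡ ⊥⊢⋀outputs
  BOT-elim-OUT₄ (WO X⊨Y d) =
    let X⊫Y = from ⊫⇔⊨ X⊨Y ; a , b = BOT-elim-OUT₄ d
    in WO⊫ (∨-monoˡ X⊫Y) a , SI⊫ (∧-mono ⊫-refl (¬-anti X⊫Y)) b
  BOT-elim-OUT₄ (SI B⊨A d) =
    let a , b = BOT-elim-OUT₄ d
    in SI B⊨A a , SI⊫ (∧-mono (from ⊫⇔⊨ B⊨A) ⊫-refl) b
  BOT-elim-OUT₄ (AND d₁ d₂) =
    let a₁ , b₁ = BOT-elim-OUT₄ d₁ ; a₂ , b₂ = BOT-elim-OUT₄ d₂
    in WO⊫ ∨-factorʳ-∧ (AND a₁ a₂) , SI⊫ ∧¬∧-split (OR tt b₁ b₂)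
  BOT-elim-OUT₄ (OR h d₁ d₂) =
    let a₁ , b₁ = BOT-elim-OUT₄ d₁ ; a₂ , b₂ = BOT-elim-OUT₄ d₂
    in OR h a₁ a₂ , SI⊫ ∧-distribʳ-∨ (OR tt b₁ b₂)
  BOT-elim-OUT₄ (CT h d₁ d₂) =
    let a₁ , b₁ = BOT-elim-OUT₄ d₁ ; a₂ , b₂ = BOT-elim-OUT₄ d₂
    in SI⊫ ∧-split (OR tt a₂ (WO⊫ ∨-introʳ b₁)) , SI⊫ ∧¬-split (OR tt b₁ b₂)

  record Approximant (k : OutK) (A X : Fm) : Set where
    constructor approximant
    field
      Z       : Fm
      ⊢Z      : Derives k false G (A , Z)
      A∧Z⊫X   : A ∧ᶠ Z ⊫ X
      Z⊫X∨O   : Z ⊫ X ∨ᶠ O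

  approximant-WO : X ⊫ Y → Approximant k A X → Approximant k A Y
  approximant-WO X⊫Y (approximant Z ⊢Z A∧Z⊫X Z⊫X∨O) =
    approximant Z ⊢Z (⊫-trans A∧Z⊫X X⊫Y) (⊫-trans Z⊫X∨O (∨-monoˡ X⊫Y))

  approximant-SI : B ⊨ A → Approximant k A X → Approximant k B X
  approximant-SI B⊨A (approximant Z ⊢Z A∧Z⊫X Z⊫X∨O) =
    approximant Z (SI B⊨A ⊢Z) (⊫-trans (∧-mono (from ⊫⇔⊨ B⊨A) ⊫-refl) A∧Z⊫X) Z⊫X∨O

  approximant-AND : Approximant k A X₁ → Approximant k A X₂ → Approximant k A (X₁ ∧ᶠ X₂)
  approximant-AND
    (approximant Z₁ ⊢Z₁ A∧Z₁⊫X₁ Z₁⊫X₁∨O) (approximant Z₂ ⊢Z₂ A∧Z₂⊫X₂ Z₂⊫X₂∨O) =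
    approximant (Z₁ ∧ᶠ Z₂) (AND ⊢Z₁ ⊢Z₂)
      (⊫-intro λ (a , z₁ , z₂) → ⊫-elim A∧Z₁⊫X₁ (a , z₁) , ⊫-elim A∧Z₂⊫X₂ (a , z₂))
      (⊫-trans (∧-mono Z₁⊫X₁∨O Z₂⊫X₂∨O) ∨-factorʳ-∧)

  approximant-CT : T (hasCT k) → Approximant k A X → Approximant k (A ∧ᶠ X) Y → Approximant k A Y
  approximant-CT {A = A} {X = X} hasCT
    (approximant Z₁ ⊢Z₁ A∧Z₁⊫X _) (approximant Z₂ ⊢Z₂ A∧X∧Z₂⊫Y Z₂⊫Y∨O) =
    approximant (Z₁ ∧ᶠ Z₂) (AND ⊢Z₁ (CT hasCT ⊢Z₁ (SI⊫ A∧Z₁⊫A∧X ⊢Z₂)))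
      (⊫-intro λ (a , z₁ , z₂) → ⊫-elim A∧X∧Z₂⊫Y (⊫-elim A∧Z₁⊫A∧X (a , z₁) , z₂))
      (⊫-trans ∧-elimʳ Z₂⊫Y∨O)
    where
    A∧Z₁⊫A∧X : A ∧ᶠ Z₁ ⊫ A ∧ᶠ X
    A∧Z₁⊫A∧X = ∧-intro ∧-elimˡ A∧Z₁⊫X

  approximate : ¬ T (hasOR k) → Derives k true G (A , X) → Approximant k A X
  approximate _ (leaf p∈G) = approximant _ (leaf p∈G) ∧-elimʳ ∨-introˡ
  approximate _ TOP = approximant ⊤ᶠ TOP ∧-elimʳ ∨-introˡ
  approximate _ (BOT _) = approximant O ⊥⊢⋀outputs ∧-elimˡ ∨-introʳ
  approximate noOR (WO X⊨Y d) = approximant-WO (from ⊫⇔⊨ X⊨Y) (approximate noOR d)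
  approximate noOR (SI B⊨A d) = approximant-SI B⊨A (approximate noOR d)
  approximate noOR (AND d₁ d₂) = approximant-AND (approximate noOR d₁) (approximate noOR d₂)
  approximate noOR (OR hasOR _ _) = ⊥-elim (noOR hasOR)
  approximate noOR (CT hasCT d₁ d₂) =
    approximant-CT hasCT (approximate noOR d₁) (approximate noOR d₂)

  BOT-elim-noOR : ¬ T (hasOR k) → Derives k true G (A , X) → Derives k false G (A , X ∨ᶠ O)
  BOT-elim-noOR noOR d = let open Approximant (approximate noOR d) in WO⊫ Z⊫X∨O ⊢Z

  BOT-elim : (k : OutK) → Derives k true G (A , X) → Derives k false G (A , X ∨ᶠ O)
  BOT-elim out1 = BOT-elim-noCT (λ ())
  BOT-elim out2 = BOT-elim-noCT (λ ())
  BOT-elim out3 = BOT-elim-noOR (λ ())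
  BOT-elim out4 = proj₁ ∘ BOT-elim-OUT₄

theorem4 : (k : OutK) (G : List Pair) (B Y : Fm) →
    Derives k false G (B , Y) ⇔ (Derives k true G (B , Y) × (outputs G ⊨* Y))
theorem4 k G B Y = mk⇔
  (λ d → OUT⊆OUT⁺ d , from ⊨*⇔⋀⊫ (sound d))
  (λ (d , G⊨Y) → WO⊫ (∨-elim ⊫-refl (to ⊨*⇔⋀⊫ G⊨Y)) (BOT-elim k d))
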